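{- Let $A$ be a good $s$-balancer and let $c\in\mathbb{N}$. The potential $\phi'_t(c)=\sum_{v\in V}\max\{c\,d^++s-x_t(v),0\}$ is non-increasing in $t$ and satisfies $\phi'_t(c)\le\phi'_{t-1}(c)-\sum_{u\in V}\Delta'_t(c,u)$, where $\Delta'_t(c,u)=\min\{x_t(u),c d^++s\}-\max\{x_{t-1}(u),c d^+\}$ if $x_{t-1}(u)<x_t(u)$, $x_{t-1}(u)<c d^++s$ and $x_t(u)>c d^+$, and $\Delta'_t(c,u)=0$ otherwise.
   Context: Model: $G=(V,E)$ is a $d$-regular graph (symmetric directed); $G^+$ adds $d^{\circ}$ self-loops per node, $d^+=d+d^{\circ}$; $E_u$ denotes the original edges out of $u$ and $E_u^+$ these together with the self-loops of $u$. $x_t(u)$ is the number of indivisible tokens at $u$ at the beginning of synchronous step $t$; in step $t$ node $u$ sends all tokens over $E_u^+$, $f_t(e)$ over edge $e$, and its new load is the number of tokens arriving. $F_t(e)=\sum_{\tau\le t}f_\tau(e)$. Good $s$-balancer ($1\le s\le d^{\circ}$): for all $t,u$, every edge of $E_u^+$ receives at least $\lfloor x_t(u)/d^+\rfloor$ tokens, and the remaining $e(u)=x_t(u)-d^+\lfloor x_t(u)/d^+\rfloor$ tokens are distributed so that (1) for any $e_1,e_2\in E_u$, $|F_t(e_1)-F_t(e_2)|\le 1$; (2) at least $\min\{s,e(u)\}$ self-loops of $u$ receive $\lceil x_t(u)/d^+\rceil$ tokens; (3) every edge of $E_u^+$ receives at most $\lceil x_t(u)/d^+\rceil$ tokens.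 -}

module Defs where

open import Data.Nat using (ℕ; zero; suc; _+_; _*_; _∸_; _≤_; _<ᵇ_; _≡ᵇ_; _⊓_; _⊔_; NonZero)
open import Data.Nat.DivMod using (_/_; _%_)
open import Data.Bool using (Bool; true; false; if_then_else_; _∧_)
open import Data.Fin using (Fin; zero; suc; _↑ˡ_; _↑ʳ_)
open import Data.Product using (Σ; _×_)
open import Function.Definitions using (Injective)
open import Relation.Binary.PropositionalEquality using (_≡_; _≢_)

ΣFin : (m : ℕ) → (Fin m → ℕ) → ℕ
ΣFin zero    g = 0
ΣFin (suc m) g = g zero + ΣFin m (λ i → g (suc i))

ΣUpTo : ℕ → (ℕ → ℕ) → ℕ
ΣUpTo zero    g = g zero
ΣUpTo (suc t) g = ΣUpTo t g + g (suc t)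

ceilDiv : ℕ → (m : ℕ) → .{{NonZero m}} → ℕ
ceilDiv x m = x / m + (if (x % m) ≡ᵇ 0 then 0 else 1)

-- The out-edges of u are indexed by Fin d; edge (u,i) goes to nb u i.
-- rev u i is the index of the reverse edge at nb u i (symmetry), and
-- the pairing (u,i) ↦ (nb u i , rev u i) is an involution.
record RegGraph (n d : ℕ) : Set where
  field
    nb      : Fin n → Fin d → Fin n
    rev     : Fin n → Fin d → Fin d
    rev-nb  : ∀ u i → nb (nb u i) (rev u i) ≡ u
    rev-rev : ∀ u i → rev (nb u i) (rev u i) ≡ i
    noLoop  : ∀ u i → nb u i ≢ u
    simple  : ∀ u i j → nb u i ≡ nb u j → i ≡ j
open RegGraph public

-- Edges of E_u^+ are indexed by Fin (d + dº):
--   i ↑ˡ dº  (i : Fin d)  = original edge (u,i)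
--   d ↑ʳ l   (l : Fin dº) = l-th self-loop of u.
-- x t u : load of u at the beginning of step t;
-- f t u k : number of tokens sent by u over its edge k in step t.

Fcum : ∀ {n D} → (ℕ → Fin n → Fin D → ℕ) → ℕ → Fin n → Fin D → ℕ
Fcum f t u k = ΣUpTo t (λ τ → f τ u k)

-- A run of the process on G^+ (dº self-loops per node, d⁺ = d + dº)
-- driven by a good s-balancer.
record GoodBalancerRun {n d : ℕ} (G : RegGraph n d) (dº s : ℕ)
       .{{nz : NonZero (d + dº)}}
       (x : ℕ → Fin n → ℕ) (f : ℕ → Fin n → Fin (d + dº) → ℕ) : Set where
  field
    sendAll : ∀ t u → ΣFin (d + dº) (f t u) ≡ x t u
    arrive  : ∀ t v → x (suc t) v ≡
                ΣFin d (λ j → f t (nb G v j) (rev G v j ↑ˡ dº))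
                + ΣFin dº (λ l → f t v (d ↑ʳ l))
    lower   : ∀ t u k → x t u / (d + dº) ≤ f t u k
    fair    : ∀ t u i j → Fcum f t u (i ↑ˡ dº) ≤ suc (Fcum f t u (j ↑ˡ dº))
    -- (2) at least min{s, e(u)} self-loops receive ⌈x/d⁺⌉
    loops   : ∀ t u → Σ (Fin (s ⊓ (x t u % (d + dº))) → Fin dº) λ g →
                Injective _≡_ _≡_ g ×
                (∀ j → f t u (d ↑ʳ g j) ≡ ceilDiv (x t u) (d + dº))
    upper   : ∀ t u k → f t u k ≤ ceilDiv (x t u) (d + dº)
open GoodBalancerRun public

φ' : ∀ {n} (dplus s : ℕ) → (ℕ → Fin n → ℕ) → ℕ → ℕ → ℕ
φ' {n} dplus s x t c = ΣFin n (λ v → (c * dplus + s) ∸ x t v)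

-- Δ'_t(c,u), with x0 = x_{t-1}(u), x1 = x_t(u)
Δ' : (dplus s c x0 x1 : ℕ) → ℕ
Δ' dplus s c x0 x1 =
  if (x0 <ᵇ x1) ∧ (x0 <ᵇ c * dplus + s) ∧ (c * dplus <ᵇ x1)
  then (x1 ⊓ (c * dplus + s)) ∸ (x0 ⊔ c * dplus)
  else 0

module Submission where

-- The potential φ'_t(c) = Σ_v (c d⁺ + s ∸ x_t(v)) measures how far the loads
-- are below the threshold Θ = c d⁺ + s.  Its deficit is charged to the edges:
-- a node u with load x sends h_k tokens over its edges k and we split
--     A(u) = Σ_{original edges i} (c ∸ h_i)           (deficit of the out-edges)
--     b(u) = (c dº + s) ∸ (tokens u keeps on its loops) (deficit of the loops).
-- Two sender inequalities, consequences of the balancing rules, hold: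
--     (P1)  A(u) + b(u) ≤ Θ ∸ x_t(u),      (P2)  Θ ∸ (x_t(u) ⊔ c d⁺) ≤ b(u).
-- On the receiving side the new load of v is what arrives over its in-edges
-- plus what v kept, so Θ ∸ x_{t+1}(v) is at most the in-edge deficit In(v) plus
-- b(v); together with (P2) this absorbs Δ'_t(c,v) too.  Because the graph is
-- symmetric, summing the in-edge deficits over all nodes gives the same total
-- as summing the out-edge deficits (double counting over the edge-reversal
-- involution), so Σ_v In(v) = Σ_u A(u), and (P1) closes the chain.

open import Defs
open import Data.Nat using (ℕ; zero; suc; _+_; _*_; _∸_; _⊔_; _⊓_; _≤_; _<_; _≤?_; _<ᵇ_; _≡ᵇ_; z≤n; s≤s; z<s; NonZero)
open import Data.Nat.Properties
open import Data.Nat.DivMod using (_/_; _%_; m≡m%n+[m/n]*n; m*n/n≡m; /-monoˡ-≤)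
open import Data.Bool using (true; false; if_then_else_; _∧_; T)
open import Data.Bool.Properties using (T-≡; T-∧)
open import Data.Fin using (Fin; zero; suc; _↑ˡ_; _↑ʳ_; punchIn; punchOut; combine; remQuot)
open import Data.Fin.Properties
  using (toℕ<n; punchIn-punchOut; punchOut-injective; remQuot-combine; combine-remQuot)
  renaming (suc-injective to Fin-suc-injective)
open import Data.Fin.Permutation using (permutation)
open import Data.Product using (Σ; _×_; _,_; proj₁; proj₂; uncurry)
open import Function using (_∘_; Equivalence)
open import Function.Definitions using (Injective)
open import Relation.Binary using (tri<; tri≈; tri>)
open import Relation.Binary.PropositionalEquality
open import Relation.Nullary using (yes; no)
open import Algebra.Properties.CommutativeSemigroup +-commutativeSemigroup using (interchange)
open import Algebra.Properties.CommutativeMonoid.Sum +-0-commutativeMonoid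
  using (sum; ∑-distrib-+; sum-remove; sum-permute)

ΣFin≡sum : ∀ m (g : Fin m → ℕ) → ΣFin m g ≡ sum g
ΣFin≡sum zero    g = refl
ΣFin≡sum (suc m) g = cong (g zero +_) (ΣFin≡sum m (g ∘ suc))

Σ-cong : ∀ m {g h : Fin m → ℕ} → (∀ i → g i ≡ h i) → ΣFin m g ≡ ΣFin m h
Σ-cong zero    e = refl
Σ-cong (suc m) e = cong₂ _+_ (e zero) (Σ-cong m (e ∘ suc))

Σ-mono : ∀ m {g h : Fin m → ℕ} → (∀ i → g i ≤ h i) → ΣFin m g ≤ ΣFin m h
Σ-mono zero    e = z≤n
Σ-mono (suc m) e = +-mono-≤ (e zero) (Σ-mono m (e ∘ suc))

Σ-+ : ∀ m (g h : Fin m → ℕ) → ΣFin m (λ i → g i + h i) ≡ ΣFin m g + ΣFin m h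
Σ-+ m g h = begin
  ΣFin m (λ i → g i + h i)  ≡⟨ ΣFin≡sum m _ ⟩
  sum (λ i → g i + h i)     ≡⟨ ∑-distrib-+ g h ⟩
  sum g + sum h             ≡⟨ sym (cong₂ _+_ (ΣFin≡sum m g) (ΣFin≡sum m h)) ⟩
  ΣFin m g + ΣFin m h       ∎
  where open ≡-Reasoning

Σ-lower : ∀ m c {g : Fin m → ℕ} → (∀ i → c ≤ g i) → m * c ≤ ΣFin m g
Σ-lower zero    c e = z≤n
Σ-lower (suc m) c e = +-mono-≤ (e zero) (Σ-lower m c (e ∘ suc))

Σ-upper : ∀ m c {g : Fin m → ℕ} → (∀ i → g i ≤ c) → ΣFin m g ≤ m * c
Σ-upper zero    c e = z≤n
Σ-upper (suc m) c e = +-mono-≤ (e zero) (Σ-upper m c (e ∘ suc))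

Σ-split : ∀ a b (g : Fin (a + b) → ℕ) →
  ΣFin (a + b) g ≡ ΣFin a (λ i → g (i ↑ˡ b)) + ΣFin b (λ l → g (a ↑ʳ l))
Σ-split zero    b g = refl
Σ-split (suc a) b g =
  trans (cong (g zero +_) (Σ-split a b (g ∘ suc))) (sym (+-assoc (g zero) _ _))

Σ-combine : ∀ m k (g : Fin (m * k) → ℕ) →
  ΣFin (m * k) g ≡ ΣFin m (λ i → ΣFin k (λ j → g (combine i j)))
Σ-combine zero    k g = refl
Σ-combine (suc m) k g =
  trans (Σ-split k (m * k) g) (cong (ΣFin k (λ j → g (j ↑ˡ (m * k))) +_) (Σ-combine m k (g ∘ (k ↑ʳ_))))

Σ²-involution : ∀ m k (σ : Fin m × Fin k → Fin m × Fin k) → (∀ p → σ (σ p) ≡ p) →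
  (a : Fin m → Fin k → ℕ) →
  ΣFin m (λ i → ΣFin k (λ j → uncurry a (σ (i , j)))) ≡ ΣFin m (λ i → ΣFin k (a i))
Σ²-involution m k σ σσ a = begin
  ΣFin m (λ i → ΣFin k (λ j → uncurry a (σ (i , j))))
    ≡⟨ Σ-cong m (λ i → Σ-cong k (λ j → cong (uncurry a) (sym (remQuot-ρ i j)))) ⟩
  ΣFin m (λ i → ΣFin k (λ j → A (ρ (combine i j))))
    ≡⟨ sym (Σ-combine m k (A ∘ ρ)) ⟩
  ΣFin (m * k) (A ∘ ρ)
    ≡⟨ ΣFin≡sum (m * k) (A ∘ ρ) ⟩
  sum (A ∘ ρ)
    ≡⟨ sym (sum-permute A (permutation ρ ρ ρρ ρρ)) ⟩
  sum A
    ≡⟨ sym (ΣFin≡sum (m * k) A) ⟩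
  ΣFin (m * k) A
    ≡⟨ Σ-combine m k A ⟩
  ΣFin m (λ i → ΣFin k (λ j → A (combine i j)))
    ≡⟨ Σ-cong m (λ i → Σ-cong k (λ j → cong (uncurry a) (remQuot-pair (i , j)))) ⟩
  ΣFin m (λ i → ΣFin k (a i))
    ∎
  where
  open ≡-Reasoning
  ρ : Fin (m * k) → Fin (m * k)
  ρ = uncurry combine ∘ σ ∘ remQuot k
  A : Fin (m * k) → ℕ
  A = uncurry a ∘ remQuot k
  remQuot-pair : ∀ p → remQuot k (uncurry combine p) ≡ p
  remQuot-pair p = remQuot-combine (proj₁ p) (proj₂ p)
  remQuot-ρ : ∀ i j → remQuot k (ρ (combine i j)) ≡ σ (i , j)
  remQuot-ρ i j = trans (remQuot-pair (σ (remQuot k (combine i j)))) (cong σ (remQuot-pair (i , j)))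
  ρρ : ∀ z → ρ (ρ z) ≡ z
  ρρ z = begin
    ρ (ρ z)                                  ≡⟨ cong (uncurry combine ∘ σ) (remQuot-pair (σ p)) ⟩
    uncurry combine (σ (σ p))                ≡⟨ cong (uncurry combine) (σσ p) ⟩
    uncurry combine p                        ≡⟨ combine-remQuot {m} k z ⟩
    z                                        ∎
    where
    p : Fin m × Fin k
    p = remQuot k z

Σ-remove : ∀ k (a : Fin (suc k)) (p : Fin (suc k) → ℕ) →
  ΣFin (suc k) p ≡ p a + ΣFin k (p ∘ punchIn a)
Σ-remove k a p = begin
  ΣFin (suc k) p                 ≡⟨ ΣFin≡sum (suc k) p ⟩
  sum p                          ≡⟨ sum-remove {i = a} p ⟩
  p a + sum (p ∘ punchIn a)      ≡⟨ cong (p a +_) (sym (ΣFin≡sum k (p ∘ punchIn a))) ⟩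
  p a + ΣFin k (p ∘ punchIn a)   ∎
  where open ≡-Reasoning

Σ-injective-≤ : ∀ m k (g : Fin m → Fin k) → Injective _≡_ _≡_ g →
  (p : Fin k → ℕ) → ΣFin m (p ∘ g) ≤ ΣFin k p
Σ-injective-≤ zero    k       g inj p = z≤n
Σ-injective-≤ (suc m) zero    g inj p with () ← g zero
Σ-injective-≤ (suc m) (suc k) g inj p = begin
  p a + ΣFin m (p ∘ g ∘ suc)
    ≡⟨ cong (p a +_) (Σ-cong m (λ j → cong p (sym (punchIn-punchOut (a≢g j))))) ⟩
  p a + ΣFin m (p ∘ punchIn a ∘ g′)
    ≤⟨ +-monoʳ-≤ (p a) (Σ-injective-≤ m k g′ g′-injective (p ∘ punchIn a)) ⟩
  p a + ΣFin k (p ∘ punchIn a)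
    ≡⟨ sym (Σ-remove k a p) ⟩
  ΣFin (suc k) p ∎
  where
  open ≤-Reasoning
  a : Fin (suc k)
  a = g zero
  a≢g : ∀ j → a ≢ g (suc j)
  a≢g j a≡g with () ← inj a≡g
  -- the remaining indices g (suc j), renumbered to avoid a
  g′ : Fin m → Fin k
  g′ j = punchOut (a≢g j)
  g′-injective : Injective _≡_ _≡_ g′
  g′-injective e = Fin-suc-injective (inj (punchOut-injective (a≢g _) (a≢g _) e))

∸-+-≤ : ∀ a b c e → (a + c) ∸ (b + e) ≤ (a ∸ b) + (c ∸ e)
∸-+-≤ a b c e = m≤n+o⇒m∸n≤o (a + c) (b + e) (begin
  a + c                           ≤⟨ +-mono-≤ (m≤n+m∸n a b) (m≤n+m∸n c e) ⟩
  (b + (a ∸ b)) + (e + (c ∸ e))   ≡⟨ interchange b (a ∸ b) e (c ∸ e) ⟩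
  (b + e) + ((a ∸ b) + (c ∸ e))   ∎)
  where open ≤-Reasoning

Σ-deficit : ∀ m c (g : Fin m → ℕ) → m * c ∸ ΣFin m g ≤ ΣFin m (λ i → c ∸ g i)
Σ-deficit zero    c g = z≤n
Σ-deficit (suc m) c g =
  ≤-trans (∸-+-≤ c (g zero) (m * c) (ΣFin m (g ∘ suc))) (+-monoʳ-≤ (c ∸ g zero) (Σ-deficit m c (g ∘ suc)))

Σ-deficit-exact : ∀ m c (g : Fin m → ℕ) → (∀ i → g i ≤ c) →
  ΣFin m (λ i → c ∸ g i) + ΣFin m g ≡ m * c
Σ-deficit-exact zero    c g g≤c = refl
Σ-deficit-exact (suc m) c g g≤c = begin
  ((c ∸ g zero) + ΣFin m (λ i → c ∸ g (suc i))) + (g zero + ΣFin m (g ∘ suc))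
    ≡⟨ interchange (c ∸ g zero) _ (g zero) _ ⟩
  ((c ∸ g zero) + g zero) + (ΣFin m (λ i → c ∸ g (suc i)) + ΣFin m (g ∘ suc))
    ≡⟨ cong₂ _+_ (m∸n+n≡m (g≤c zero)) (Σ-deficit-exact m c (g ∘ suc) (g≤c ∘ suc)) ⟩
  c + m * c ∎
  where open ≡-Reasoning

-- ⌈x/D⌉ = ⌊x/D⌋ + roundUp (x mod D), definitionally.
roundUp : ℕ → ℕ
roundUp r = if r ≡ᵇ 0 then 0 else 1

module _ (D : ℕ) .{{_ : NonZero D}} where

  ceil≤suc-floor : ∀ x → ceilDiv x D ≤ suc (x / D)
  ceil≤suc-floor x = ≤-trans (+-monoʳ-≤ (x / D) (roundUp≤1 (x % D))) (≤-reflexive (+-comm (x / D) 1))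
    where
    roundUp≤1 : ∀ r → roundUp r ≤ 1
    roundUp≤1 zero    = z≤n
    roundUp≤1 (suc r) = ≤-refl

  ceil≡suc-floor : ∀ x → 1 ≤ x % D → ceilDiv x D ≡ suc (x / D)
  ceil≡suc-floor x 1≤r = trans (cong (x / D +_) (roundUp-pos 1≤r)) (+-comm (x / D) 1)
    where
    roundUp-pos : ∀ {r} → 1 ≤ r → roundUp r ≡ 1
    roundUp-pos {suc r} _ = refl

  ≤-floor : ∀ x c → c * D ≤ x → c ≤ x / D
  ≤-floor x c cD≤x = subst (_≤ x / D) (m*n/n≡m c D) (/-monoˡ-≤ D cD≤x)

  ceil≤ : ∀ x c → x ≤ c * D → ceilDiv x D ≤ c
  ceil≤ x c x≤cD with x % D | m≡m%n+[m/n]*n x D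
  ... | zero  | _    = ≤-trans (≤-reflexive (+-identityʳ (x / D))) floor≤c
    where
    floor≤c : x / D ≤ c
    floor≤c = subst (x / D ≤_) (m*n/n≡m c D) (/-monoˡ-≤ D x≤cD)
  ... | suc r | x≡r+qD = ≤-trans (≤-reflexive (+-comm (x / D) 1)) floor<c
    where
    floor<c : x / D < c
    floor<c = *-cancelʳ-< D (x / D) c (begin-strict
      x / D * D            <⟨ m<n+m (x / D * D) z<s ⟩
      suc r + x / D * D    ≡⟨ sym x≡r+qD ⟩
      x                    ≤⟨ x≤cD ⟩
      c * D                ∎)
      where open ≤-Reasoning

∸-gap : ∀ {M x N} → M ≤ x → M ≤ N → (N ∸ x) + ((x ⊓ N) ∸ M) ≡ N ∸ M
∸-gap {M} {x} {N} M≤x M≤N with x ≤? N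
... | yes x≤N = begin
  (N ∸ x) + ((x ⊓ N) ∸ M)   ≡⟨ cong (λ y → (N ∸ x) + (y ∸ M)) (m≤n⇒m⊓n≡m x≤N) ⟩
  (N ∸ x) + (x ∸ M)         ≡⟨ sym (+-∸-assoc (N ∸ x) M≤x) ⟩
  ((N ∸ x) + x) ∸ M         ≡⟨ cong (_∸ M) (m∸n+n≡m x≤N) ⟩
  N ∸ M                     ∎
  where open ≡-Reasoning
... | no x≰N = cong₂ (λ y z → y + (z ∸ M)) (m≤n⇒m∸n≡0 N≤x) (m≥n⇒m⊓n≡n N≤x)
  where
  N≤x : N ≤ x
  N≤x = <⇒≤ (≰⇒> x≰N)

-- When Δ' is active it is exactly the
-- part of the interval [x0 ⊔ c D , x1] lying below Θ.
Δ'-bound : ∀ D s c x0 x1 →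
  (c * D + s ∸ x1) + Δ' D s c x0 x1 ≤ (c * D + s ∸ x1) ⊔ (c * D + s ∸ (x0 ⊔ c * D))
Δ'-bound D s c x0 x1 with (x0 <ᵇ x1) ∧ (x0 <ᵇ c * D + s) ∧ (c * D <ᵇ x1) in active
... | false = ≤-trans (≤-reflexive (+-identityʳ _)) (m≤m⊔n _ _)
... | true  = ≤-trans (≤-reflexive (∸-gap M≤x1 M≤Θ)) (m≤n⊔m _ _)
  where
  conditions : T (x0 <ᵇ x1) × T ((x0 <ᵇ c * D + s) ∧ (c * D <ᵇ x1))
  conditions = Equivalence.to T-∧ (Equivalence.from T-≡ active)
  x0<x1 : x0 < x1
  x0<x1 = <ᵇ⇒< x0 x1 (proj₁ conditions)
  x0<Θ : x0 < c * D + s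
  x0<Θ = <ᵇ⇒< x0 _ (proj₁ (Equivalence.to T-∧ (proj₂ conditions)))
  cD<x1 : c * D < x1
  cD<x1 = <ᵇ⇒< _ x1 (proj₂ (Equivalence.to T-∧ (proj₂ conditions)))
  M≤x1 : x0 ⊔ c * D ≤ x1
  M≤x1 = ⊔-lub (<⇒≤ x0<x1) (<⇒≤ cD<x1)
  M≤Θ : x0 ⊔ c * D ≤ c * D + s
  M≤Θ = ⊔-lub (<⇒≤ x0<Θ) (m≤m+n (c * D) s)

-- The threshold c d⁺ + s is c d (for the original edges) plus c dº + s
-- (for the self-loops).
threshold-split : ∀ c d dº s → c * (d + dº) + s ≡ c * d + (c * dº + s)
threshold-split c d dº s = trans (cong (_+ s) (*-distribˡ-+ c d dº)) (+-assoc (c * d) (c * dº) s)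

-- Receiving side at one node: the new load x1 = I + L consists of I tokens
-- arriving over the d original in-edges and L tokens kept on the loops.
receiver-bound : ∀ d dº s c x0 x1 I L In → x1 ≡ I + L → c * d ∸ I ≤ In →
  (c * (d + dº) + s) ∸ (x0 ⊔ c * (d + dº)) ≤ (c * dº + s) ∸ L →
  ((c * (d + dº) + s) ∸ x1) + Δ' (d + dº) s c x0 x1 ≤ In + ((c * dº + s) ∸ L)
receiver-bound d dº s c x0 x1 I L In x1≡I+L cd∸I≤In P2 =
  ≤-trans (Δ'-bound (d + dº) s c x0 x1) (⊔-lub new-gap (≤-trans P2 (m≤n+m _ In)))
  where
  open ≤-Reasoning
  new-gap : (c * (d + dº) + s) ∸ x1 ≤ In + ((c * dº + s) ∸ L)
  new-gap = begin
    (c * (d + dº) + s) ∸ x1          ≡⟨ cong₂ _∸_ (threshold-split c d dº s) x1≡I+L ⟩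
    (c * d + (c * dº + s)) ∸ (I + L) ≤⟨ ∸-+-≤ (c * d) I (c * dº + s) L ⟩
    (c * d ∸ I) + ((c * dº + s) ∸ L) ≤⟨ +-monoˡ-≤ _ cd∸I≤In ⟩
    In + ((c * dº + s) ∸ L)          ∎

module Sender (d dº s c : ℕ) .{{_ : NonZero (d + dº)}} (s≤dº : s ≤ dº)
  (x : ℕ) (h : Fin (d + dº) → ℕ)
  (sends-all : ΣFin (d + dº) h ≡ x)
  (at-least-floor : ∀ k → x / (d + dº) ≤ h k)
  (at-most-ceil : ∀ k → h k ≤ ceilDiv x (d + dº))
  (loops-at-ceil : Σ (Fin (s ⊓ (x % (d + dº))) → Fin dº) λ g → Injective _≡_ _≡_ g ×
                     (∀ j → h (d ↑ʳ g j) ≡ ceilDiv x (d + dº)))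
  where

  D Θ K q r : ℕ
  D = d + dº
  Θ = c * D + s
  K = c * dº + s
  q = x / D
  r = x % D

  out kept : ℕ
  out  = ΣFin d (λ i → h (i ↑ˡ dº))
  kept = ΣFin dº (λ l → h (d ↑ʳ l))

  outDeficit keptDeficit : ℕ
  outDeficit  = ΣFin d (λ i → c ∸ h (i ↑ˡ dº))
  keptDeficit = K ∸ kept

  out+kept : out + kept ≡ x
  out+kept = trans (sym (Σ-split d dº h)) sends-all

  x≡r+qD : x ≡ r + q * D
  x≡r+qD = m≡m%n+[m/n]*n x D

  outDeficit≡0 : c ≤ q → outDeficit ≡ 0
  outDeficit≡0 c≤q = n≤0⇒n≡0 (≤-trans (Σ-upper d 0 (λ i → ≤-reflexive (m≤n⇒m∸n≡0 (c≤h i))))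
                                        (≤-reflexive (*-zeroʳ d)))
    where
    c≤h : ∀ i → c ≤ h (i ↑ˡ dº)
    c≤h i = ≤-trans c≤q (at-least-floor _)

  -- every loop carries ⌊x/D⌋, and min{s, x mod D} of them one token more
  kept-lower : s ⊓ r + dº * q ≤ kept
  kept-lower = begin
    s ⊓ r + dº * q
      ≤⟨ +-mono-≤ surplus (Σ-lower dº q (λ _ → ≤-refl)) ⟩
    ΣFin dº (λ l → h (d ↑ʳ l) ∸ q) + ΣFin dº (λ _ → q)
      ≡⟨ sym (Σ-+ dº _ _) ⟩
    ΣFin dº (λ l → h (d ↑ʳ l) ∸ q + q)
      ≡⟨ Σ-cong dº (λ l → m∸n+n≡m (at-least-floor _)) ⟩
    kept ∎
    where
    open ≤-Reasoning
    g = proj₁ loops-at-ceil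
    one-more : ∀ j → 1 ≤ h (d ↑ʳ g j) ∸ q
    one-more j = ≤-reflexive (sym (begin-equality
      h (d ↑ʳ g j) ∸ q   ≡⟨ cong (_∸ q) (proj₂ (proj₂ loops-at-ceil) j) ⟩
      ceilDiv x D ∸ q    ≡⟨ cong (_∸ q) (ceil≡suc-floor D x 1≤r) ⟩
      suc q ∸ q          ≡⟨ m+n∸n≡m 1 q ⟩
      1                  ∎))
      where
      1≤r : 1 ≤ r
      1≤r = ≤-trans (≤-trans (s≤s z≤n) (toℕ<n j)) (m⊓n≤n s r)
    surplus : s ⊓ r ≤ ΣFin dº (λ l → h (d ↑ʳ l) ∸ q)
    surplus = begin
      s ⊓ r                                     ≡⟨ sym (*-identityʳ (s ⊓ r)) ⟩
      s ⊓ r * 1                                 ≤⟨ Σ-lower (s ⊓ r) 1 one-more ⟩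
      ΣFin (s ⊓ r) (λ j → h (d ↑ʳ g j) ∸ q)     ≤⟨ Σ-injective-≤ (s ⊓ r) dº g (proj₁ (proj₂ loops-at-ceil)) _ ⟩
      ΣFin dº (λ l → h (d ↑ʳ l) ∸ q)            ∎

  P1 : outDeficit + keptDeficit ≤ Θ ∸ x
  P1 with <-cmp c q
  ... | tri< c<q _ _ = begin
    outDeficit + keptDeficit   ≡⟨ cong₂ _+_ (outDeficit≡0 (<⇒≤ c<q)) (m≤n⇒m∸n≡0 K≤kept) ⟩
    0                          ≤⟨ z≤n ⟩
    Θ ∸ x                      ∎
    where
    open ≤-Reasoning
    K≤kept : K ≤ kept
    K≤kept = begin
      c * dº + s        ≤⟨ +-monoʳ-≤ (c * dº) s≤dº ⟩
      c * dº + dº       ≡⟨ +-comm (c * dº) dº ⟩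
      suc c * dº        ≤⟨ *-monoˡ-≤ dº c<q ⟩
      q * dº            ≡⟨ *-comm q dº ⟩
      dº * q            ≤⟨ m≤n+m (dº * q) (s ⊓ r) ⟩
      s ⊓ r + dº * q    ≤⟨ kept-lower ⟩
      kept              ∎
  ... | tri≈ _ c≡q _ = begin
    outDeficit + keptDeficit        ≡⟨ cong (_+ keptDeficit) (outDeficit≡0 (≤-reflexive c≡q)) ⟩
    K ∸ kept                        ≤⟨ ∸-monoʳ-≤ K kept-lower ⟩
    (c * dº + s) ∸ (s ⊓ r + dº * q) ≡⟨ cong (λ y → (c * dº + s) ∸ (s ⊓ r + y)) dºq≡cdº ⟩
    (c * dº + s) ∸ (s ⊓ r + c * dº) ≡⟨ cong ((c * dº + s) ∸_) (+-comm (s ⊓ r) (c * dº)) ⟩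
    (c * dº + s) ∸ (c * dº + s ⊓ r) ≡⟨ [m+n]∸[m+o]≡n∸o (c * dº) s (s ⊓ r) ⟩
    s ∸ (s ⊓ r)                     ≡⟨ s∸s⊓r ⟩
    s ∸ r                           ≡⟨ sym ([m+n]∸[m+o]≡n∸o (c * D) s r) ⟩
    (c * D + s) ∸ (c * D + r)       ≡⟨ cong (Θ ∸_) (trans (+-comm (c * D) r) (cong (λ y → r + y * D) c≡q)) ⟩
    Θ ∸ (r + q * D)                 ≡⟨ cong (Θ ∸_) (sym x≡r+qD) ⟩
    Θ ∸ x                           ∎
    where
    open ≤-Reasoning
    dºq≡cdº : dº * q ≡ c * dº
    dºq≡cdº = trans (*-comm dº q) (cong (_* dº) (sym c≡q))
    s∸s⊓r : s ∸ (s ⊓ r) ≡ s ∸ r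
    s∸s⊓r = trans (∸-distribˡ-⊓-⊔ s s r) (cong (_⊔ (s ∸ r)) (n∸n≡0 s))
  ... | tri> _ _ q<c = ≤-reflexive (sym (begin-equality
    Θ ∸ x
      ≡⟨ cong₂ _∸_ (threshold-split c d dº s) (sym out+kept) ⟩
    (c * d + K) ∸ (out + kept)
      ≡⟨ cong₂ (λ y z → (y + z) ∸ (out + kept)) (trans (*-comm c d) (sym out-exact)) (sym kept-exact) ⟩
    ((outDeficit + out) + (keptDeficit + kept)) ∸ (out + kept)
      ≡⟨ cong (_∸ (out + kept)) (interchange outDeficit out keptDeficit kept) ⟩
    ((outDeficit + keptDeficit) + (out + kept)) ∸ (out + kept)
      ≡⟨ m+n∸n≡m (outDeficit + keptDeficit) (out + kept) ⟩
    outDeficit + keptDeficit ∎))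
    where
    open ≤-Reasoning
    -- below threshold c every edge carries at most ⌈x/D⌉ ≤ ⌊x/D⌋ + 1 ≤ c tokens
    h≤c : ∀ k → h k ≤ c
    h≤c k = ≤-trans (at-most-ceil k) (≤-trans (ceil≤suc-floor D x) q<c)
    out-exact : outDeficit + out ≡ d * c
    out-exact = Σ-deficit-exact d c _ (λ i → h≤c _)
    kept-exact : keptDeficit + kept ≡ K
    kept-exact = m∸n+n≡m (begin
      kept     ≤⟨ Σ-upper dº c (λ l → h≤c _) ⟩
      dº * c   ≡⟨ *-comm dº c ⟩
      c * dº   ≤⟨ m≤m+n (c * dº) s ⟩
      K        ∎)

  P2 : Θ ∸ (x ⊔ c * D) ≤ keptDeficit
  P2 with x ≤? c * D
  ... | yes x≤cD = begin
    Θ ∸ (x ⊔ c * D)      ≡⟨ cong (Θ ∸_) (m≤n⇒m⊔n≡n x≤cD) ⟩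
    (c * D + s) ∸ c * D  ≡⟨ m+n∸m≡n (c * D) s ⟩
    s                    ≡⟨ sym (m+n∸m≡n (c * dº) s) ⟩
    K ∸ c * dº           ≤⟨ ∸-monoʳ-≤ K kept≤cdº ⟩
    K ∸ kept             ∎
    where
    open ≤-Reasoning
    -- with x ≤ c D every edge carries at most ⌈x/D⌉ ≤ c tokens
    kept≤cdº : kept ≤ c * dº
    kept≤cdº = ≤-trans (Σ-upper dº c (λ l → ≤-trans (at-most-ceil _) (ceil≤ D x c x≤cD)))
                       (≤-reflexive (*-comm dº c))
  ... | no x≰cD = begin
    Θ ∸ (x ⊔ c * D)              ≡⟨ cong (Θ ∸_) (m≥n⇒m⊔n≡m (<⇒≤ cD<x)) ⟩
    Θ ∸ x                        ≡⟨ cong₂ _∸_ (threshold-split c d dº s) (sym out+kept) ⟩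
    (c * d + K) ∸ (out + kept)   ≤⟨ ∸-monoʳ-≤ (c * d + K) (+-monoˡ-≤ kept cd≤out) ⟩
    (c * d + K) ∸ (c * d + kept) ≡⟨ [m+n]∸[m+o]≡n∸o (c * d) K kept ⟩
    K ∸ kept                     ∎
    where
    open ≤-Reasoning
    cD<x : c * D < x
    cD<x = ≰⇒> x≰cD
    -- above c D every edge, in particular every original edge, carries ≥ c
    cd≤out : c * d ≤ out
    cd≤out = ≤-trans (≤-reflexive (*-comm c d))
               (Σ-lower d c (λ i → ≤-trans (≤-floor D x c (<⇒≤ cD<x)) (at-least-floor _)))

-- Double counting on a symmetric graph: summing over all edges (v , j) a
-- quantity attached to the reverse edge gives the same total, because
-- (v , j) ↦ (nb v j , rev v j) is an involution of the edge set.
Σ-reverse-edges : ∀ {n d} (G : RegGraph n d) (a : Fin n → Fin d → ℕ) →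
  ΣFin n (λ v → ΣFin d (λ j → a (nb G v j) (rev G v j))) ≡ ΣFin n (λ u → ΣFin d (a u))
Σ-reverse-edges {n} {d} G a = Σ²-involution n d reverse reverse-involutive a
  where
  reverse : Fin n × Fin d → Fin n × Fin d
  reverse (v , j) = nb G v j , rev G v j
  reverse-involutive : ∀ e → reverse (reverse e) ≡ e
  reverse-involutive (v , j) = cong₂ _,_ (rev-nb G v j) (rev-rev G v j)

-- Summing the receiver bound over all nodes, the in-edge deficits become the
-- out-edge deficits (double counting) and (P1) bounds them by φ'_t(c).
lemma3 : ∀ {n d} (G : RegGraph n d) (dº s : ℕ) → 1 ≤ s → s ≤ dº →
    .{{nz : NonZero (d + dº)}} →
    (x : ℕ → Fin n → ℕ) (f : ℕ → Fin n → Fin (d + dº) → ℕ) →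
    GoodBalancerRun G dº s x f →
    (c t : ℕ) →
    φ' (d + dº) s x (suc t) c ≤ φ' (d + dº) s x t c
    × φ' (d + dº) s x (suc t) c
        + ΣFin n (λ u → Δ' (d + dº) s c (x t u) (x (suc t) u))
      ≤ φ' (d + dº) s x t c
lemma3 {n} {d} G dº s _ s≤dº x f run c t = ≤-trans (m≤m+n _ _) drop , drop
  where
  module S (u : Fin n) = Sender d dº s c s≤dº (x t u) (f t u)
    (sendAll run t u) (lower run t u) (upper run t u) (loops run t u)
  Θ : ℕ
  Θ = c * (d + dº) + s
  incoming : Fin n → Fin d → ℕ
  incoming v j = f t (nb G v j) (rev G v j ↑ˡ dº)
  inDeficit : Fin n → ℕ
  inDeficit v = ΣFin d (λ j → c ∸ incoming v j)
  node : ∀ v → (Θ ∸ x (suc t) v) + Δ' (d + dº) s c (x t v) (x (suc t) v) ≤ inDeficit v + S.keptDeficit v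
  node v = receiver-bound d dº s c (x t v) (x (suc t) v) (ΣFin d (incoming v)) (S.kept v) (inDeficit v)
    (arrive run t v) (subst (λ y → y ∸ ΣFin d (incoming v) ≤ inDeficit v) (*-comm d c) (Σ-deficit d c (incoming v)))
    (S.P2 v)
  drop : φ' (d + dº) s x (suc t) c + ΣFin n (λ u → Δ' (d + dº) s c (x t u) (x (suc t) u)) ≤ φ' (d + dº) s x t c
  drop = begin
    φ' (d + dº) s x (suc t) c + ΣFin n (λ u → Δ' (d + dº) s c (x t u) (x (suc t) u))
      ≡⟨ sym (Σ-+ n _ _) ⟩
    ΣFin n (λ v → (Θ ∸ x (suc t) v) + Δ' (d + dº) s c (x t v) (x (suc t) v))
      ≤⟨ Σ-mono n node ⟩
    ΣFin n (λ v → inDeficit v + S.keptDeficit v)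
      ≡⟨ Σ-+ n inDeficit S.keptDeficit ⟩
    ΣFin n inDeficit + ΣFin n S.keptDeficit
      ≡⟨ cong (_+ ΣFin n S.keptDeficit) (Σ-reverse-edges G (λ u i → c ∸ f t u (i ↑ˡ dº))) ⟩
    ΣFin n S.outDeficit + ΣFin n S.keptDeficit
      ≡⟨ sym (Σ-+ n S.outDeficit S.keptDeficit) ⟩
    ΣFin n (λ u → S.outDeficit u + S.keptDeficit u)
      ≤⟨ Σ-mono n S.P1 ⟩
    φ' (d + dº) s x t c ∎
    where open ≤-Reasoning
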